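{- Let $q$ be an odd prime power and let $\chi_1$ be the coloring defined below on $V=(\mathbb{F}_q^*)^3$. Then $\chi_1$ induces a proper edge coloring on every one-dimensional affine subspace: if $a,b,c$ are three distinct vectors of $V$ lying on a common one-dimensional affine subspace of $\mathbb{F}_q^3$, then $\chi_1(a,b)\neq\chi_1(a,c)$.
   Context: $q$ is an odd prime power, $\mathbb{F}_q^*$ the nonzero elements of $\mathbb{F}_q$, and $V=(\mathbb{F}_q^*)^3$. For $x,y\in\mathbb{F}_q^3$, $x\cdot y=x_1y_1+x_2y_2+x_3y_3$. Fix an arbitrary linear order $<$ on $\mathbb{F}_q$ and extend it lexicographically to vectors: $x<y$ iff $x_i<y_i$ at the first position $i$ where $x_i\neq y_i$. For distinct $x,y\in V$ define $T(x,y)$ to be: $\mathrm{UP}_1$ if $x\cdot y=x\cdot x$ and $x_1<y_1$; $\mathrm{UP}_2$ if $x\cdot y=x\cdot x$, $x_1=y_1$ and $x<y$; $\mathrm{DOWN}_1$ if $x\cdot y\ne x\cdot x$, $x\cdot y=y\cdot y$ and $x_1<y_1$; $\mathrm{DOWN}_2$ if $x\cdot y\neq x\cdot x$, $x\cdot y=y\cdot y$, $x_1=y_1$ and $x<y$; $\mathrm{ZERO}$ if $x\cdot y\notin\{x\cdot x,y\cdot y\}$ and $x\cdot y=0$; $\mathrm{DOT}$ otherwise. Let $f_T(x,y)=x_1+y_1$ if $T\in\{\mathrm{UP}_1,\mathrm{DOWN}_1,\mathrm{ZERO}\}$, $f_T(x,y)=x_2+y_2$ if $T\in\{\mathrm{UP}_2,\mathrm{DOWN}_2\}$,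 and $f_T(x,y)=x\cdot y$ if $T=\mathrm{DOT}$. Let $\delta(x,y)=0$ if $\{x,y\}$ is linearly dependent and $1$ otherwise. For $x<y$ set $\chi_1(x,y)=(T,f_T(x,y),\delta(x,y))$ with $T=T(x,y)$; this is the color of the edge $\{x,y\}$, so $\chi_1(y,x)=\chi_1(x,y)$. -}

module Defs where

open import Data.Nat using (ℕ)
open import Data.Fin using (Fin)
open import Data.Fin.Properties using (any?)
open import Data.Product using (Σ; ∃; ∃₂; _×_; _,_; proj₁; proj₂)
open import Data.Product.Properties using (≡-dec)
open import Data.Bool using (Bool; true; false; if_then_else_)
open import Relation.Binary.PropositionalEquality using (_≡_; _≢_; refl; subst; sym)
open import Relation.Nullary using (¬_; Dec; yes; no)
open import Relation.Nullary.Decidable using (⌊_⌋; _×-dec_; ¬?)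
open import Relation.Binary.Definitions using (DecidableEquality; Tri; tri<; tri≈; tri>)
open import Relation.Binary.Structures using (IsStrictTotalOrder)
open import Algebra.Structures using (IsCommutativeRing)
open import Function.Bundles using (_↔_; Inverse)

-- A finite field of odd order q.  Every finite field has prime-power order,
-- and "q odd" is equivalent to 1 + 1 ≢ 0 (characteristic ≠ 2).
record OddFiniteField : Set₁ where
  infixl 6 _+_
  infixl 7 _*_
  field
    F                 : Set
    _+_ _*_           : F → F → F
    -_                : F → F
    0# 1#             : F
    isCommutativeRing : IsCommutativeRing _≡_ _+_ _*_ -_ 0# 1#
    0≢1               : 0# ≢ 1#
    hasInverse        : ∀ x → x ≢ 0# → ∃ λ y → x * y ≡ 1#
    _≟_               : DecidableEquality F
    q                 : ℕ
    enumeration       : F ↔ Fin q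
    oddChar           : 1# + 1# ≢ 0#

module Coloring (K : OddFiniteField)
                (_<_ : OddFiniteField.F K → OddFiniteField.F K → Set)
                (isSTO : IsStrictTotalOrder _≡_ _<_) where
  open OddFiniteField K
  open IsStrictTotalOrder isSTO using (compare)

  F³ : Set
  F³ = F × F × F

  _∙_ : F³ → F³ → F
  (x₁ , x₂ , x₃) ∙ (y₁ , y₂ , y₃) = x₁ * y₁ + x₂ * y₂ + x₃ * y₃

  _⊕_ : F³ → F³ → F³
  (x₁ , x₂ , x₃) ⊕ (y₁ , y₂ , y₃) = (x₁ + y₁ , x₂ + y₂ , x₃ + y₃)

  _·_ : F → F³ → F³
  a · (x₁ , x₂ , x₃) = (a * x₁ , a * x₂ , a * x₃)

  𝟎 : F³
  𝟎 = (0# , 0# , 0#)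

  fst snd : F³ → F
  fst (x₁ , _ , _) = x₁
  snd (_ , x₂ , _) = x₂

  InV : F³ → Set
  InV (x₁ , x₂ , x₃) = x₁ ≢ 0# × x₂ ≢ 0# × x₃ ≢ 0#

  OnCommonLine : F³ → F³ → F³ → Set
  OnCommonLine a b c = Σ F³ λ p → Σ F³ λ d → d ≢ 𝟎 ×
    (∃ λ s → a ≡ p ⊕ (s · d)) × (∃ λ t → b ≡ p ⊕ (t · d)) × (∃ λ u → c ≡ p ⊕ (u · d))

  LinDep : F³ → F³ → Set
  LinDep x y = ∃₂ λ α β → ¬ (α ≡ 0# × β ≡ 0#) × (α · x) ⊕ (β · y) ≡ 𝟎

  _≟³_ : DecidableEquality F³
  _≟³_ = ≡-dec _≟_ (≡-dec _≟_ _≟_)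

  private
    open Inverse enumeration using (to; from; strictlyInverseʳ)
    ∃F? : (P : F → Set) → (∀ x → Dec (P x)) → Dec (∃ P)
    ∃F? P P? with any? (λ i → P? (from i))
    ... | yes (i , p) = yes (from i , p)
    ... | no ¬p = no λ { (x , px) → ¬p (to x , subst P (sym (strictlyInverseʳ x)) px) }

  LinDep? : ∀ x y → Dec (LinDep x y)
  LinDep? x y = ∃F? _ λ α → ∃F? _ λ β →
    ¬? ((α ≟ 0#) ×-dec (β ≟ 0#)) ×-dec (((α · x) ⊕ (β · y)) ≟³ 𝟎)

  eqb : F → F → Bool
  eqb a b = ⌊ a ≟ b ⌋

  ltb : F → F → Bool
  ltb a b with compare a b
  ... | tri< _ _ _ = true
  ... | tri≈ _ _ _ = false
  ... | tri> _ _ _ = false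

  _∧_ : Bool → Bool → Bool
  true ∧ b = b
  false ∧ _ = false

  not : Bool → Bool
  not true = false
  not false = true

  lexLt : F³ → F³ → Bool
  lexLt (x₁ , x₂ , x₃) (y₁ , y₂ , y₃) =
    if ltb x₁ y₁ then true
    else if eqb x₁ y₁ then
      (if ltb x₂ y₂ then true
       else if eqb x₂ y₂ then ltb x₃ y₃ else false)
    else false

  data EdgeType : Set where
    UP₁ UP₂ DOWN₁ DOWN₂ ZERO DOT : EdgeType

  T : F³ → F³ → EdgeType
  T x y =
    if eqb (x ∙ y) (x ∙ x) ∧ ltb (fst x) (fst y) then UP₁
    else if eqb (x ∙ y) (x ∙ x) ∧ (eqb (fst x) (fst y) ∧ lexLt x y) then UP₂
    else if not (eqb (x ∙ y) (x ∙ x)) ∧ (eqb (x ∙ y) (y ∙ y) ∧ ltb (fst x) (fst y)) then DOWN₁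
    else if not (eqb (x ∙ y) (x ∙ x)) ∧ (eqb (x ∙ y) (y ∙ y) ∧ (eqb (fst x) (fst y) ∧ lexLt x y)) then DOWN₂
    else if not (eqb (x ∙ y) (x ∙ x)) ∧ (not (eqb (x ∙ y) (y ∙ y)) ∧ eqb (x ∙ y) 0#) then ZERO
    else DOT

  f : EdgeType → F³ → F³ → F
  f UP₁   x y = fst x + fst y
  f DOWN₁ x y = fst x + fst y
  f ZERO  x y = fst x + fst y
  f UP₂   x y = snd x + snd y
  f DOWN₂ x y = snd x + snd y
  f DOT   x y = x ∙ y

  δ : F³ → F³ → ℕ
  δ x y = if ⌊ LinDep? x y ⌋ then 0 else 1

  Color : Set
  Color = EdgeType × F × ℕ

  -- color of the ordered pair with x < y
  χ₀ : F³ → F³ → Color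
  χ₀ x y = (T x y , f (T x y) x y , δ x y)

  χ₁ : F³ → F³ → Color
  χ₁ x y = if lexLt x y then χ₀ x y else χ₀ y x

-- Along a line p + t·d every coordinate, and every functional x ∙ _, is an
-- affine function of t; if it takes the same value at two distinct points of
-- the line, it is constant on the line.  Equal colours on ab and ac (a, b, c on
-- a line) give exactly such a coincidence: of a₁ + b₁ and a₁ + c₁ for the
-- types UP₁, DOWN₁; of a₂ + b₂ and a₂ + c₂ for UP₂, DOWN₂; of a ∙ b and a ∙ c
-- for ZERO, DOT.  So a₁ = b₁, contradicting the type; or a₁ = b₁ and a₂ = b₂,
-- so a, b differ only in their (nonzero) third coordinates and a ∙ b is
-- neither a ∙ a nor b ∙ b, contradicting the type; or a ∙ a = a ∙ b,
-- contradicting the type again.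
module Submission where

open import Defs
open import Relation.Binary.PropositionalEquality using (_≡_; _≢_)
open import Relation.Binary.Structures using (IsStrictTotalOrder)

open import Level using (0ℓ)
open import Algebra.Bundles using (CommutativeRing)
open import Data.Bool using (Bool; true; false; if_then_else_)
open import Data.Empty using (⊥; ⊥-elim)
open import Data.Maybe using (nothing)
open import Data.Product using (_×_; _,_; proj₁; proj₂)
open import Data.Sum using (_⊎_; inj₁; inj₂; [_,_])
open import Relation.Binary.Definitions using (tri<; tri≈; tri>)
open import Relation.Binary.PropositionalEquality
  using (refl; sym; trans; cong; subst; module ≡-Reasoning)
open import Relation.Nullary using (yes; no)
import Algebra.Properties.Group as GroupProperties
import Tactic.RingSolver.Core.AlmostCommutativeRing as ACR
import Tactic.RingSolver.NonReflective as RingSolver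

if-elim : ∀ {a p} {A : Set a} (P : A → Set p) b {x y : A} →
          (b ≡ true → P x) → (b ≡ false → P y) → P (if b then x else y)
if-elim P true  onTrue onFalse = onTrue refl
if-elim P false onTrue onFalse = onFalse refl

module FieldProperties (K : OddFiniteField) where
  open OddFiniteField K

  commutativeRing : CommutativeRing 0ℓ 0ℓ
  commutativeRing = record { isCommutativeRing = isCommutativeRing }

  open CommutativeRing commutativeRing public
    using (+-comm; *-comm; *-assoc; *-identityˡ; zeroʳ)
  open GroupProperties (CommutativeRing.+-group commutativeRing) public
    using () renaming (∙-cancelˡ to +-cancelˡ)
  open RingSolver (ACR.fromCommutativeRing commutativeRing (λ _ → nothing)) public
    using (solve; _⊜_) renaming (_⊕_ to _:+_; _⊗_ to _:*_)

  *-cancelˡ-≢0 : ∀ {x y z} → x ≢ 0# → x * y ≡ x * z → y ≡ z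
  *-cancelˡ-≢0 {x} {y} {z} x≢0 xy≡xz with hasInverse x x≢0
  ... | w , xw≡1 = begin
    y             ≡⟨ sym (*-identityˡ y) ⟩
    1# * y        ≡⟨ cong (_* y) (trans (sym xw≡1) (*-comm x w)) ⟩
    (w * x) * y   ≡⟨ *-assoc w x y ⟩
    w * (x * y)   ≡⟨ cong (w *_) xy≡xz ⟩
    w * (x * z)   ≡⟨ sym (*-assoc w x z) ⟩
    (w * x) * z   ≡⟨ cong (_* z) (trans (*-comm w x) xw≡1) ⟩
    1# * z        ≡⟨ *-identityˡ z ⟩
    z             ∎
    where open ≡-Reasoning

  affine-constant : ∀ {α β t u} → t ≢ u → α + t * β ≡ α + u * β →
                    ∀ s → α + s * β ≡ α + t * β
  affine-constant {α} {β} {t} {u} t≢u αtβ≡αuβ s with β ≟ 0#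
  ... | yes refl = trans (cong (α +_) (zeroʳ s)) (cong (α +_) (sym (zeroʳ t)))
  ... | no β≢0 = ⊥-elim (t≢u (*-cancelˡ-≢0 β≢0
        (trans (*-comm β t) (trans (+-cancelˡ α _ _ αtβ≡αuβ) (*-comm u β)))))

module _ (K : OddFiniteField)
         (_<_ : OddFiniteField.F K → OddFiniteField.F K → Set)
         (isSTO : IsStrictTotalOrder _≡_ _<_) where
  open OddFiniteField K
  open Coloring K _<_ isSTO
  open IsStrictTotalOrder isSTO using (compare; irrefl)
  open FieldProperties K

  eqb-true⇒≡ : ∀ {a b} → eqb a b ≡ true → a ≡ b
  eqb-true⇒≡ {a} {b} _ with a ≟ b
  eqb-true⇒≡ _  | yes a≡b = a≡b
  eqb-true⇒≡ () | no _

  eqb-false⇒≢ : ∀ {a b} → eqb a b ≡ false → a ≢ b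
  eqb-false⇒≢ {a} {b} _ with a ≟ b
  eqb-false⇒≢ () | yes _
  eqb-false⇒≢ _  | no a≢b = a≢b

  eqb-refl : ∀ a → eqb a a ≡ true
  eqb-refl a with a ≟ a
  ... | yes _   = refl
  ... | no a≢a = ⊥-elim (a≢a refl)

  ltb-true⇒≢ : ∀ {a b} → ltb a b ≡ true → a ≢ b
  ltb-true⇒≢ {a} {b} _ with compare a b
  ltb-true⇒≢ _  | tri< _ a≢b _ = a≢b
  ltb-true⇒≢ () | tri≈ _ _ _
  ltb-true⇒≢ () | tri> _ _ _

  ltb-complete : ∀ {a b} → a < b → ltb a b ≡ true
  ltb-complete {a} {b} a<b with compare a b
  ... | tri< _ _ _    = refl
  ... | tri≈ a≮b _ _ = ⊥-elim (a≮b a<b)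
  ... | tri> a≮b _ _ = ⊥-elim (a≮b a<b)

  ltb-irrefl : ∀ a → ltb a a ≡ false
  ltb-irrefl a with compare a a
  ... | tri< a<a _ _ = ⊥-elim (irrefl refl a<a)
  ... | tri≈ _ _ _   = refl
  ... | tri> _ _ a<a = ⊥-elim (irrefl refl a<a)

  ltb-connex : ∀ {a b} → a ≢ b → ltb a b ≡ false → ltb b a ≡ true
  ltb-connex {a} {b} a≢b a≮b with compare a b
  ltb-connex a≢b () | tri< _ _ _
  ltb-connex a≢b _  | tri≈ _ a≡b _ = ⊥-elim (a≢b a≡b)
  ltb-connex a≢b _  | tri> _ _ b<a = ltb-complete b<a

  -- lexLt x y is definitionally lexStep x₁ y₁ (lexStep x₂ y₂ (ltb x₃ y₃)).
  lexStep : F → F → Bool → Bool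
  lexStep a b r = if ltb a b then true else if eqb a b then r else false

  lexStep-connex : ∀ {a b r r′} → (a ≡ b → r ≡ false → r′ ≡ true) →
                   lexStep a b r ≡ false → lexStep b a r′ ≡ true
  lexStep-connex {a} {b} next a≮b with compare a b
  lexStep-connex next () | tri< _ _ _
  ... | tri≈ _ refl _ rewrite ltb-irrefl a | eqb-refl a = next refl a≮b
  ... | tri> _ _ b<a rewrite ltb-complete b<a = refl

  lexLt-connex : ∀ {x y} → x ≢ y → lexLt x y ≡ false → lexLt y x ≡ true
  lexLt-connex {x₁ , x₂ , x₃} {y₁ , y₂ , y₃} x≢y =
    lexStep-connex λ { refl → lexStep-connex λ { refl → ltb-connex λ { refl → x≢y refl } } }

  ∙-comm : ∀ x y → x ∙ y ≡ y ∙ x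
  ∙-comm (x₁ , x₂ , x₃) (y₁ , y₂ , y₃) =
    solve 6 (λ x₁ x₂ x₃ y₁ y₂ y₃ →
      (x₁ :* y₁ :+ x₂ :* y₂ :+ x₃ :* y₃) ⊜ (y₁ :* x₁ :+ y₂ :* x₂ :+ y₃ :* x₃))
      refl x₁ x₂ x₃ y₁ y₂ y₃

  ∙-affine : ∀ x p t d → x ∙ (p ⊕ (t · d)) ≡ x ∙ p + t * (x ∙ d)
  ∙-affine (x₁ , x₂ , x₃) (p₁ , p₂ , p₃) t (d₁ , d₂ , d₃) =
    solve 10 (λ x₁ x₂ x₃ p₁ p₂ p₃ t d₁ d₂ d₃ →
      (x₁ :* (p₁ :+ t :* d₁) :+ x₂ :* (p₂ :+ t :* d₂) :+ x₃ :* (p₃ :+ t :* d₃))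
        ⊜ ((x₁ :* p₁ :+ x₂ :* p₂ :+ x₃ :* p₃) :+ t :* (x₁ :* d₁ :+ x₂ :* d₂ :+ x₃ :* d₃)))
      refl x₁ x₂ x₃ p₁ p₂ p₃ t d₁ d₂ d₃

  DotAvoidsSquares : F³ → F³ → Set
  DotAvoidsSquares x y = x ∙ y ≢ x ∙ x × x ∙ y ≢ y ∙ y

  FirstDistinct : F → F³ → F³ → Set
  FirstDistinct v x y = v ≡ fst x + fst y × fst x ≢ fst y

  FirstEqual : F → F³ → F³ → Set
  FirstEqual v x y = v ≡ snd x + snd y × fst x ≡ fst y × (x ∙ y ≡ x ∙ x ⊎ x ∙ y ≡ y ∙ y)

  -- What the colour of the edge {x, y} reveals about x and y; unlike the
  -- colour itself it does not refer to the order of x and y.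
  Certifies : Color → F³ → F³ → Set
  Certifies (UP₁   , v , _) = FirstDistinct v
  Certifies (DOWN₁ , v , _) = FirstDistinct v
  Certifies (UP₂   , v , _) = FirstEqual v
  Certifies (DOWN₂ , v , _) = FirstEqual v
  Certifies (ZERO  , _ , _) x y = x ∙ y ≡ 0# × DotAvoidsSquares x y
  Certifies (DOT   , v , _) x y = v ≡ x ∙ y × DotAvoidsSquares x y

  T-certifies : ∀ {x y} → lexLt x y ≡ true → Certifies (χ₀ x y) x y
  T-certifies {x} {y} x<y
    with eqb (x ∙ y) (x ∙ x) in up | eqb (x ∙ y) (y ∙ y) in down | eqb (x ∙ y) 0# in zero
       | ltb (fst x) (fst y) in x₁<y₁ | eqb (fst x) (fst y) in x₁≟y₁
  ... | true  | _     | _     | true  | _ = refl , ltb-true⇒≢ x₁<y₁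
  ... | false | true  | _     | true  | _ = refl , ltb-true⇒≢ x₁<y₁
  ... | false | false | true  | true  | _ = eqb-true⇒≡ zero , eqb-false⇒≢ up , eqb-false⇒≢ down
  ... | false | false | false | true  | _ = refl , eqb-false⇒≢ up , eqb-false⇒≢ down
  T-certifies () | _ | _ | _ | false | false
  ... | true  | _     | _     | false | true rewrite x<y =
    refl , eqb-true⇒≡ x₁≟y₁ , inj₁ (eqb-true⇒≡ up)
  ... | false | true  | _     | false | true rewrite x<y =
    refl , eqb-true⇒≡ x₁≟y₁ , inj₂ (eqb-true⇒≡ down)
  ... | false | false | true  | false | true = eqb-true⇒≡ zero , eqb-false⇒≢ up , eqb-false⇒≢ down
  ... | false | false | false | false | true = refl , eqb-false⇒≢ up , eqb-false⇒≢ down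

  DotAvoidsSquares-sym : ∀ {x y} → DotAvoidsSquares x y → DotAvoidsSquares y x
  DotAvoidsSquares-sym {x} {y} (xy≢xx , xy≢yy) =
    (λ yx≡yy → xy≢yy (trans (∙-comm x y) yx≡yy)) ,
    (λ yx≡xx → xy≢xx (trans (∙-comm x y) yx≡xx))

  FirstDistinct-sym : ∀ {v x y} → FirstDistinct v x y → FirstDistinct v y x
  FirstDistinct-sym {x = x} {y} (v≡x₁+y₁ , x₁≢y₁) =
    trans v≡x₁+y₁ (+-comm (fst x) (fst y)) , λ y₁≡x₁ → x₁≢y₁ (sym y₁≡x₁)

  FirstEqual-sym : ∀ {v x y} → FirstEqual v x y → FirstEqual v y x
  FirstEqual-sym {x = x} {y} (v≡x₂+y₂ , x₁≡y₁ , upOrDown) =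
    trans v≡x₂+y₂ (+-comm (snd x) (snd y)) , sym x₁≡y₁ , swap upOrDown
    where
    swap : x ∙ y ≡ x ∙ x ⊎ x ∙ y ≡ y ∙ y → y ∙ x ≡ y ∙ y ⊎ y ∙ x ≡ x ∙ x
    swap (inj₁ xy≡xx) = inj₂ (trans (∙-comm y x) xy≡xx)
    swap (inj₂ xy≡yy) = inj₁ (trans (∙-comm y x) xy≡yy)

  Certifies-sym : ∀ κ {x y} → Certifies κ x y → Certifies κ y x
  Certifies-sym (UP₁   , v , _) {x} {y} = FirstDistinct-sym {v} {x} {y}
  Certifies-sym (DOWN₁ , v , _) {x} {y} = FirstDistinct-sym {v} {x} {y}
  Certifies-sym (UP₂   , v , _) {x} {y} = FirstEqual-sym {v} {x} {y}
  Certifies-sym (DOWN₂ , v , _) {x} {y} = FirstEqual-sym {v} {x} {y}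
  Certifies-sym (ZERO  , _ , _) {x} {y} (xy≡0 , avoids) =
    trans (∙-comm y x) xy≡0 , DotAvoidsSquares-sym avoids
  Certifies-sym (DOT   , _ , _) {x} {y} (v≡xy , avoids) =
    trans v≡xy (∙-comm x y) , DotAvoidsSquares-sym avoids

  χ₁-certifies : ∀ {x y} → x ≢ y → Certifies (χ₁ x y) x y
  χ₁-certifies {x} {y} x≢y = if-elim (λ κ → Certifies κ x y) (lexLt x y) T-certifies
    (λ x≮y → Certifies-sym (χ₀ y x) (T-certifies (lexLt-connex x≢y x≮y)))

  DotAvoidsSquares-if-only-third-differs : ∀ {x y} → InV x → InV y → x ≢ y →
    fst x ≡ fst y → snd x ≡ snd y → DotAvoidsSquares x y
  DotAvoidsSquares-if-only-third-differs {x₁ , x₂ , x₃} {_ , _ , y₃}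
    (_ , _ , x₃≢0) (_ , _ , y₃≢0) x≢y refl refl =
    (λ xy≡xx → x≢y (cong third (sym (*-cancelˡ-≢0 x₃≢0 (+-cancelˡ _ _ _ xy≡xx))))) ,
    (λ xy≡yy → x≢y (cong third (*-cancelˡ-≢0 y₃≢0
                    (trans (*-comm y₃ x₃) (+-cancelˡ _ _ _ xy≡yy)))))
    where third : F → F³
          third z = x₁ , x₂ , z

  module OnLine {p d : F³} {s t u : F} (t≢u : t ≢ u) where

    a b c : F³
    a = p ⊕ (s · d)
    b = p ⊕ (t · d)
    c = p ⊕ (u · d)

    fst-collision : fst b ≡ fst c → fst a ≡ fst b
    fst-collision b₁≡c₁ = affine-constant t≢u b₁≡c₁ s

    snd-collision : snd b ≡ snd c → snd a ≡ snd b
    snd-collision b₂≡c₂ = affine-constant t≢u b₂≡c₂ s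

    ∙-collision : ∀ x → x ∙ b ≡ x ∙ c → x ∙ a ≡ x ∙ b
    ∙-collision x xb≡xc = begin
      x ∙ a                  ≡⟨ ∙-affine x p s d ⟩
      x ∙ p + s * (x ∙ d)    ≡⟨ affine-constant t≢u xp+t*xd≡xp+u*xd s ⟩
      x ∙ p + t * (x ∙ d)    ≡⟨ sym (∙-affine x p t d) ⟩
      x ∙ b                  ∎
      where
      open ≡-Reasoning
      xp+t*xd≡xp+u*xd : x ∙ p + t * (x ∙ d) ≡ x ∙ p + u * (x ∙ d)
      xp+t*xd≡xp+u*xd = trans (sym (∙-affine x p t d)) (trans xb≡xc (∙-affine x p u d))

    FirstDistinct-collision : ∀ {v} → FirstDistinct v a b → FirstDistinct v a c → ⊥
    FirstDistinct-collision (v≡a₁+b₁ , a₁≢b₁) (v≡a₁+c₁ , _) =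
      a₁≢b₁ (fst-collision (+-cancelˡ (fst a) _ _ (trans (sym v≡a₁+b₁) v≡a₁+c₁)))

    FirstEqual-collision : ∀ {v} → InV a → InV b → a ≢ b →
                           FirstEqual v a b → FirstEqual v a c → ⊥
    FirstEqual-collision inV-a inV-b a≢b (v≡a₂+b₂ , a₁≡b₁ , upOrDown) (v≡a₂+c₂ , _) =
      [ proj₁ avoids , proj₂ avoids ] upOrDown
      where
      a₂≡b₂ : snd a ≡ snd b
      a₂≡b₂ = snd-collision (+-cancelˡ (snd a) _ _ (trans (sym v≡a₂+b₂) v≡a₂+c₂))
      avoids : DotAvoidsSquares a b
      avoids = DotAvoidsSquares-if-only-third-differs inV-a inV-b a≢b a₁≡b₁ a₂≡b₂

    no-common-certificate : InV a → InV b → a ≢ b →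
                            ∀ κ → Certifies κ a b → Certifies κ a c → ⊥
    no-common-certificate _ _ _ (UP₁   , _ , _) = FirstDistinct-collision
    no-common-certificate _ _ _ (DOWN₁ , _ , _) = FirstDistinct-collision
    no-common-certificate inV-a inV-b a≢b (UP₂   , _ , _) = FirstEqual-collision inV-a inV-b a≢b
    no-common-certificate inV-a inV-b a≢b (DOWN₂ , _ , _) = FirstEqual-collision inV-a inV-b a≢b
    no-common-certificate _ _ _ (ZERO  , _ , _) (ab≡0 , avoids) (ac≡0 , _) =
      proj₁ avoids (sym (∙-collision a (trans ab≡0 (sym ac≡0))))
    no-common-certificate _ _ _ (DOT   , _ , _) (v≡ab , avoids) (v≡ac , _) =
      proj₁ avoids (sym (∙-collision a (trans (sym v≡ab) v≡ac)))

  χ₁-proper-on-lines : ∀ {a b c} → InV a → InV b → a ≢ b → a ≢ c → b ≢ c →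
                       OnCommonLine a b c → χ₁ a b ≢ χ₁ a c
  χ₁-proper-on-lines inV-a inV-b a≢b a≢c b≢c
    (p , d , _ , (s , refl) , (t , refl) , (u , refl)) χab≡χac =
    no-common-certificate inV-a inV-b a≢b (χ₁ _ _) (χ₁-certifies a≢b)
      (subst (λ κ → Certifies κ _ _) (sym χab≡χac) (χ₁-certifies a≢c))
    where
    -- b ≢ c already separates the parameters.
    t≢u : t ≢ u
    t≢u t≡u = b≢c (cong (λ r → p ⊕ (r · d)) t≡u)
    open OnLine t≢u

mainTheorem9 : (K : OddFiniteField)
    → (_<_ : OddFiniteField.F K → OddFiniteField.F K → Set)
    → (isSTO : IsStrictTotalOrder _≡_ _<_)
    → (a b c : Coloring.F³ K _<_ isSTO)
    → Coloring.InV K _<_ isSTO a → Coloring.InV K _<_ isSTO b → Coloring.InV K _<_ isSTO c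
    → a ≢ b → a ≢ c → b ≢ c
    → Coloring.OnCommonLine K _<_ isSTO a b c
    → Coloring.χ₁ K _<_ isSTO a b ≢ Coloring.χ₁ K _<_ isSTO a c
mainTheorem9 K _<_ isSTO _ _ _ inV-a inV-b _ a≢b a≢c b≢c =
  χ₁-proper-on-lines K _<_ isSTO inV-a inV-b a≢b a≢c b≢c
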